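{- For any job set $S'$ with $|S'|=t$ in a three-machine permutation flowshop, the number $|OptPerm(S')|$ of its Pareto permutations is $O^*(2^t)$.
   Context: Three-machine flowshop: each job $i$ has non-negative integer processing times $p_{i1},p_{i2},p_{i3}$ on machines 1, 2, 3, processed in that order; each machine processes one job at a time. A permutation $\pi$ of jobs is scheduled from time $0$ as a permutation schedule (same order on all machines, every operation as early as possible); $C^M_j(\pi)$ is the completion time of the last job of $\pi$ on machine $j$. The criteria vector of $\pi$ is $\langle C^M_2(\pi),C^M_3(\pi)\rangle$. Given a set of permutations of a job set, its Pareto permutations are the permutations whose criteria vector is not dominated (componentwise $\le$ with at least one strict inequality) by the criteria vector of another permutation in the set; when several permutations have the same non-dominated criteria vector, only one of them (arbitrary) is retained. $OptPerm(S')$ is the set of Pareto permutations of the set of all permutations of $S'$. Notation: $f(t)=O^*(g(t))$ means $f(t)=O(p(t)g(t))$ for some polynomial $p$. -}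

module Defs where

open import Data.Nat using (ℕ; zero; suc; _+_; _*_; _^_; _≤_; _<_; _⊔_)
open import Data.Product using (_×_; _,_; proj₁; proj₂)
open import Data.Sum using (_⊎_)
open import Data.Fin using (Fin)
open import Data.Fin.Permutation using (Permutation′; _⟨$⟩ʳ_)
open import Data.List using (List; []; _∷_; map; allFin; foldl)
open import Relation.Nullary using (¬_)

-- A job: processing times (p1 , p2 , p3) on machines 1, 2, 3.
Job : Set
Job = ℕ × ℕ × ℕ

-- Completion times (C1 , C2 , C3) of the last scheduled job on each machine.
Times : Set
Times = ℕ × ℕ × ℕ

step : Times → Job → Times
step (c1 , c2 , c3) (a , b , c) =
  let c1' = c1 + a
      c2' = (c2 ⊔ c1') + b
      c3' = (c3 ⊔ c2') + c
  in c1' , c2' , c3'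

schedule : List Job → Times
schedule = foldl step (0 , 0 , 0)

sequenceOf : ∀ {t} → (Fin t → Job) → Permutation′ t → List Job
sequenceOf {t} jobs π = map (λ i → jobs (π ⟨$⟩ʳ i)) (allFin t)

criteria : ∀ {t} → (Fin t → Job) → Permutation′ t → ℕ × ℕ
criteria jobs π = let s = schedule (sequenceOf jobs π) in
  proj₁ (proj₂ s) , proj₂ (proj₂ s)

Dominates : ℕ × ℕ → ℕ × ℕ → Set
Dominates (u1 , u2) (v1 , v2) = u1 ≤ v1 × u2 ≤ v2 × (u1 < v1 ⊎ u2 < v2)

Pareto : ∀ {t} → (Fin t → Job) → Permutation′ t → Set
Pareto {t} jobs π = (σ : Permutation′ t) → ¬ Dominates (criteria jobs σ) (criteria jobs π)

-- Along a permutation schedule the second machine finishes at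
-- max over positions j of (p₁ of the first j jobs) + (p₂ of the jobs from j on),
-- so C²(π) is a sum that takes, for every job, either its p₁ or its p₂, plus one
-- further p₂.  There are at most 2^t · (t + 1) such numbers.  Two Pareto
-- permutations with different criteria vectors cannot share C², since otherwise
-- the one with the smaller C³ would dominate the other; hence there are at most
-- (t + 1) · 2^t ≤ 2 · t · 2^t Pareto permutations.
module Submission where

open import Defs
open import Data.Nat using (ℕ; _*_; _^_; _≤_)
open import Data.Product using (Σ)
open import Data.Fin using (Fin)
open import Data.Fin.Permutation using (Permutation′)
open import Data.List using (List; length)
open import Data.List.Relation.Unary.All using (All)
open import Data.List.Relation.Unary.AllPairs using (AllPairs)
open import Relation.Binary.PropositionalEquality using (_≢_)

open import Data.Bool using (Bool; true; false; if_then_else_)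
open import Data.Nat using (suc; _+_; _⊔_; _<_)
open import Data.Nat.Properties
open import Data.Nat.Solver using (module +-*-Solver)
open import Data.Product using (_,_; proj₁; proj₂; _×_)
open import Data.Sum using (_⊎_; inj₁; inj₂)
open import Data.Fin using (zero; suc)
open import Data.Fin.Permutation using (_⟨$⟩ʳ_; _⟨$⟩ˡ_; inverseˡ)
open import Data.Fin.Properties using (injective⇒≤)
open import Data.List using ([]; _∷_; map; allFin; foldl; tabulate; _++_; lookup; cartesianProductWith)
open import Data.List.Properties using (map-tabulate; length-++; length-map; length-tabulate)
open import Data.List.Membership.Propositional using (_∈_)
open import Data.List.Membership.Propositional.Properties
  using (∈-++⁺ˡ; ∈-++⁺ʳ; ∈-map⁺; ∈-map⁻; ∈-allFin; ∈-lookup; ∈-cartesianProductWith⁺)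
open import Data.List.Relation.Binary.Subset.Propositional using (_⊆_)
open import Data.List.Relation.Unary.Any using (here; index)
open import Data.List.Relation.Unary.Any.Properties using (lookup-index)
open import Data.List.Relation.Unary.Unique.Propositional using (Unique)
import Data.List.Relation.Unary.All as All
open import Data.List.Relation.Unary.All using ([]; _∷_)
import Data.List.Relation.Unary.AllPairs as AllPairs
open import Data.List.Relation.Unary.AllPairs using ([]; _∷_)
open import Data.List.Relation.Unary.AllPairs.Properties using (map⁺)
open import Relation.Binary.PropositionalEquality
  using (_≡_; refl; sym; trans; cong; cong₂; subst; module ≡-Reasoning)
open import Relation.Binary.Definitions using (tri<; tri≈; tri>)
open import Relation.Nullary using (yes; no)
open import Relation.Nullary.Negation using (contradiction)
open import Algebra.Properties.CommutativeMonoid.Sum +-0-commutativeMonoid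
  using (sum; sum-permute; sum-cong-≗)

unique-lookup-injective : ∀ {A : Set} {xs : List A} → Unique xs →
  ∀ i j → lookup xs i ≡ lookup xs j → i ≡ j
unique-lookup-injective (_ ∷ _) zero zero _ = refl
unique-lookup-injective (x∉xs ∷ _) zero (suc j) eq = contradiction eq (All.lookup x∉xs (∈-lookup j))
unique-lookup-injective (x∉xs ∷ _) (suc i) zero eq = contradiction (sym eq) (All.lookup x∉xs (∈-lookup i))
unique-lookup-injective (_ ∷ xs!) (suc i) (suc j) eq = cong suc (unique-lookup-injective xs! i j eq)

unique⇒length≤ : ∀ {A : Set} {xs ys : List A} → Unique xs → xs ⊆ ys → length xs ≤ length ys
unique⇒length≤ {xs = xs} {ys} xs! xs⊆ys = injective⇒≤ position-injective
  where
  position : Fin (length xs) → Fin (length ys)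
  position i = index (xs⊆ys (∈-lookup i))

  position-injective : ∀ {i j} → position i ≡ position j → i ≡ j
  position-injective {i} {j} eq = unique-lookup-injective xs! i j (begin
    lookup xs i                ≡⟨ lookup-index (xs⊆ys (∈-lookup i)) ⟩
    lookup ys (position i)     ≡⟨ cong (lookup ys) eq ⟩
    lookup ys (position j)     ≡⟨ lookup-index (xs⊆ys (∈-lookup j)) ⟨
    lookup xs j                ∎)
    where open ≡-Reasoning

length-cartesianProductWith : ∀ {A B C : Set} (f : A → B → C) xs ys →
  length (cartesianProductWith f xs ys) ≡ length xs * length ys
length-cartesianProductWith f [] ys = refl
length-cartesianProductWith f (x ∷ xs) ys = trans (length-++ (map (f x) ys))
  (cong₂ _+_ (length-map (f x) ys) (length-cartesianProductWith f xs ys))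

All⇒AllPairs× : ∀ {A : Set} {P : A → Set} {xs : List A} → All P xs → AllPairs (λ x y → P x × P y) xs
All⇒AllPairs× [] = []
All⇒AllPairs× (px ∷ pxs) = All.map (px ,_) pxs ∷ All⇒AllPairs× pxs

p₁ p₂ : Job → ℕ
p₁ = proj₁
p₂ job = proj₁ (proj₂ job)

mixedSum : ∀ {n} → (Fin n → Bool) → (Fin n → Job) → ℕ
mixedSum b g = sum (λ i → if b i then p₁ (g i) else p₂ (g i))

mixedSums : ∀ {n} → (Fin n → Job) → List ℕ
mixedSums {0} g = 0 ∷ []
mixedSums {suc n} g = map (p₁ (g zero) +_) rest ++ map (p₂ (g zero) +_) rest
  where rest = mixedSums (λ i → g (suc i))

length-mixedSums : ∀ {n} (g : Fin n → Job) → length (mixedSums g) ≡ 2 ^ n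
length-mixedSums {0} g = refl
length-mixedSums {suc n} g = begin
  length (map (p₁ (g zero) +_) rest ++ map (p₂ (g zero) +_) rest)
    ≡⟨ length-++ (map (p₁ (g zero) +_) rest) ⟩
  length (map (p₁ (g zero) +_) rest) + length (map (p₂ (g zero) +_) rest)
    ≡⟨ cong₂ _+_ (length-map _ rest) (length-map _ rest) ⟩
  length rest + length rest
    ≡⟨ cong (λ m → m + m) (length-mixedSums (λ i → g (suc i))) ⟩
  2 ^ n + 2 ^ n
    ≡⟨ cong (2 ^ n +_) (+-identityʳ (2 ^ n)) ⟨
  2 ^ suc n ∎
  where
  open ≡-Reasoning
  rest = mixedSums (λ i → g (suc i))

mixedSum∈mixedSums : ∀ {n} (b : Fin n → Bool) (g : Fin n → Job) → mixedSum b g ∈ mixedSums g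
mixedSum∈mixedSums {0} b g = here refl
mixedSum∈mixedSums {suc n} b g with b zero
... | true  = ∈-++⁺ˡ (∈-map⁺ _ (mixedSum∈mixedSums (λ i → b (suc i)) (λ i → g (suc i))))
... | false = ∈-++⁺ʳ _ (∈-map⁺ _ (mixedSum∈mixedSums (λ i → b (suc i)) (λ i → g (suc i))))

mixedSum-permute : ∀ {n} (b : Fin n → Bool) (g : Fin n → Job) (π : Permutation′ n) →
  mixedSum b (λ i → g (π ⟨$⟩ʳ i)) ≡ mixedSum (λ k → b (π ⟨$⟩ˡ k)) g
mixedSum-permute b g π = sym (trans (sum-permute _ π)
  (sum-cong-≗ λ i → cong (λ c → if b c then p₁ (g (π ⟨$⟩ʳ i)) else p₂ (g (π ⟨$⟩ʳ i))) (inverseˡ π)))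

completion₂ : Times → ℕ
completion₂ s = proj₁ (proj₂ s)

C² : ∀ {t} → (Fin t → Job) → Permutation′ t → ℕ
C² jobs π = proj₁ (criteria jobs π)

-- Possible values of completion₂ after scheduling g from completion times c₁, c₂:
-- machine 2 never waits for machine 1, or it last waits for it at position j
-- (then b marks the positions up to j, which contribute their p₁).
data Completion₂Form {n} (g : Fin n → Job) (c₁ c₂ : ℕ) : ℕ → Set where
  unblocked : Completion₂Form g c₁ c₂ (c₂ + sum (λ i → p₂ (g i)))
  blocked   : ∀ b j → Completion₂Form g c₁ c₂ (c₁ + mixedSum b g + p₂ (g j))

⊔-+-ahead : ∀ {c₁ c₂} b s → c₁ ≤ c₂ → (c₂ ⊔ c₁) + b + s ≡ c₂ + (b + s)
⊔-+-ahead {c₂ = c₂} b s c₁≤c₂ = trans (cong (λ m → m + b + s) (m≥n⇒m⊔n≡m c₁≤c₂)) (+-assoc c₂ b s)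

⊔-+-behind : ∀ {c₂} c₁ a b s → c₂ < c₁ + a → (c₂ ⊔ (c₁ + a)) + b + s ≡ c₁ + (a + s) + b
⊔-+-behind c₁ a b s c₂<c₁′ =
  trans (cong (λ m → m + b + s) (m≤n⇒m⊔n≡n (<⇒≤ c₂<c₁′))) (regroup c₁ a b s)
  where
  regroup : ∀ c a b s → c + a + b + s ≡ c + (a + s) + b
  regroup = solve 4 (λ c a b s → c :+ a :+ b :+ s := c :+ (a :+ s) :+ b) refl
    where open +-*-Solver

completion₂-cons : ∀ {n} (g : Fin (suc n) → Job) c₁ c₂ {r} →
  let c₁′ = c₁ + p₁ (g zero) in
  Completion₂Form (λ i → g (suc i)) c₁′ ((c₂ ⊔ c₁′) + p₂ (g zero)) r →
  Completion₂Form g c₁ c₂ r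
completion₂-cons g c₁ c₂ unblocked with c₁ + p₁ (g zero) ≤? c₂
... | yes c₁′≤c₂ = subst (Completion₂Form g c₁ c₂) (sym (⊔-+-ahead _ _ c₁′≤c₂)) unblocked
... | no c₁′≰c₂ = subst (Completion₂Form g c₁ c₂) (sym (⊔-+-behind c₁ _ _ _ (≰⇒> c₁′≰c₂)))
  (blocked (λ { zero → true ; (suc _) → false }) zero)
completion₂-cons g c₁ c₂ (blocked b j) =
  subst (Completion₂Form g c₁ c₂) (cong (_+ p₂ (g (suc j))) (sym (+-assoc c₁ _ _)))
    (blocked (λ { zero → true ; (suc i) → b i }) (suc j))

completion₂-form : ∀ {n} (g : Fin n → Job) c₁ c₂ c₃ →
  Completion₂Form g c₁ c₂ (completion₂ (foldl step (c₁ , c₂ , c₃) (tabulate g)))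
completion₂-form {0} g c₁ c₂ c₃ = subst (Completion₂Form g c₁ c₂) (+-identityʳ c₂) unblocked
completion₂-form {suc n} g c₁ c₂ c₃ =
  completion₂-cons g c₁ c₂ (completion₂-form (λ i → g (suc i)) _ _ _)

candidates : ∀ {t} → (Fin t → Job) → List ℕ
candidates {t} jobs =
  mixedSums jobs ++ cartesianProductWith _+_ (mixedSums jobs) (map (λ k → p₂ (jobs k)) (allFin t))

length-candidates : ∀ {t} (jobs : Fin t → Job) → length (candidates jobs) ≡ 2 ^ t + 2 ^ t * t
length-candidates {t} jobs = begin
  length (mixedSums jobs ++ products)
    ≡⟨ length-++ (mixedSums jobs) ⟩
  length (mixedSums jobs) + length products
    ≡⟨ cong (length (mixedSums jobs) +_) (length-cartesianProductWith _+_ (mixedSums jobs) p₂s) ⟩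
  length (mixedSums jobs) + length (mixedSums jobs) * length p₂s
    ≡⟨ cong₂ (λ m k → m + m * k) (length-mixedSums jobs)
             (trans (length-map _ (allFin t)) (length-tabulate (λ i → i))) ⟩
  2 ^ t + 2 ^ t * t ∎
  where
  open ≡-Reasoning
  p₂s = map (λ k → p₂ (jobs k)) (allFin t)
  products = cartesianProductWith _+_ (mixedSums jobs) p₂s

C²∈candidates : ∀ {t} (jobs : Fin t → Job) (π : Permutation′ t) → C² jobs π ∈ candidates jobs
C²∈candidates {t} jobs π =
  subst (λ l → completion₂ (schedule l) ∈ candidates jobs) (sym (map-tabulate (λ i → i) sequence))
    (candidate (completion₂-form sequence 0 0 0))
  where
  sequence : Fin t → Job
  sequence i = jobs (π ⟨$⟩ʳ i)

  mixed∈mixedSums : ∀ b → mixedSum b sequence ∈ mixedSums jobs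
  mixed∈mixedSums b =
    subst (_∈ mixedSums jobs) (sym (mixedSum-permute b jobs π)) (mixedSum∈mixedSums _ jobs)

  candidate : ∀ {r} → Completion₂Form sequence 0 0 r → r ∈ candidates jobs
  candidate unblocked = ∈-++⁺ˡ (mixed∈mixedSums (λ _ → false))
  candidate (blocked b j) = ∈-++⁺ʳ (mixedSums jobs)
    (∈-cartesianProductWith⁺ _+_ (mixed∈mixedSums b) (∈-map⁺ _ (∈-allFin (π ⟨$⟩ʳ j))))

≡first⇒Dominates : ∀ {u v : ℕ × ℕ} → u ≢ v → proj₁ u ≡ proj₁ v → Dominates u v ⊎ Dominates v u
≡first⇒Dominates {u₁ , u₂} {v₁ , v₂} u≢v refl with <-cmp u₂ v₂
... | tri< u₂<v₂ _ _ = inj₁ (≤-refl , <⇒≤ u₂<v₂ , inj₂ u₂<v₂)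
... | tri≈ _ refl _  = contradiction refl u≢v
... | tri> _ _ v₂<u₂ = inj₂ (≤-refl , <⇒≤ v₂<u₂ , inj₂ v₂<u₂)

pareto-C²-injective : ∀ {t} (jobs : Fin t → Job) {π σ : Permutation′ t} →
  Pareto jobs π × Pareto jobs σ → criteria jobs π ≢ criteria jobs σ →
  C² jobs π ≢ C² jobs σ
pareto-C²-injective jobs {π} {σ} (π-pareto , σ-pareto) ≢criteria ≡C²
  with ≡first⇒Dominates ≢criteria ≡C²
... | inj₁ π≻σ = σ-pareto π π≻σ
... | inj₂ σ≻π = π-pareto σ σ≻π

candidate-bound : ∀ t → 1 ≤ t → 2 ^ t + 2 ^ t * t ≤ 2 * t ^ 1 * 2 ^ t
candidate-bound t 1≤t = begin
  2 ^ t + 2 ^ t * t     ≤⟨ +-monoˡ-≤ (2 ^ t * t) (subst (_≤ 2 ^ t * t) (*-identityʳ (2 ^ t)) (*-monoʳ-≤ (2 ^ t) 1≤t)) ⟩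
  2 ^ t * t + 2 ^ t * t ≡⟨ double (2 ^ t) t ⟩
  2 * t ^ 1 * 2 ^ t     ∎
  where
  open ≤-Reasoning
  double : ∀ x t → x * t + x * t ≡ 2 * (t * 1) * x
  double = solve 2 (λ x t → x :* t :+ x :* t := con 2 :* (t :* con 1) :* x) refl
    where open +-*-Solver

C²-unique : ∀ {t} (jobs : Fin t → Job) {L : List (Permutation′ t)} → All (Pareto jobs) L →
  AllPairs (λ π σ → criteria jobs π ≢ criteria jobs σ) L → Unique (map (C² jobs) L)
C²-unique jobs pareto distinct =
  map⁺ (AllPairs.zipWith (λ {π} {σ} (both , ≢criteria) → pareto-C²-injective jobs {π} {σ} both ≢criteria)
                         (All⇒AllPairs× pareto , distinct))

C²⊆candidates : ∀ {t} (jobs : Fin t → Job) (L : List (Permutation′ t)) → map (C² jobs) L ⊆ candidates jobs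
C²⊆candidates jobs L x∈ with ∈-map⁻ (C² jobs) x∈
... | π , _ , refl = C²∈candidates jobs π

lemma2p1 : Σ ℕ λ c → Σ ℕ λ k → Σ ℕ λ t₀ →
    (t : ℕ) → t₀ ≤ t → (jobs : Fin t → Job) → (L : List (Permutation′ t)) →
    All (Pareto jobs) L →
    AllPairs (λ π σ → criteria jobs π ≢ criteria jobs σ) L →
    length L ≤ c * t ^ k * 2 ^ t
lemma2p1 = 2 , 1 , 1 , λ t 1≤t jobs L pareto distinct → begin
  length L                  ≡⟨ length-map (C² jobs) L ⟨
  length (map (C² jobs) L)  ≤⟨ unique⇒length≤ (C²-unique jobs pareto distinct) (C²⊆candidates jobs L) ⟩
  length (candidates jobs)  ≡⟨ length-candidates jobs ⟩
  2 ^ t + 2 ^ t * t         ≤⟨ candidate-bound t 1≤t ⟩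
  2 * t ^ 1 * 2 ^ t         ∎
  where open ≤-Reasoning
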